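{- Let $n\ge1$ and let $\eta\in\mathfrak{S}_n$ be $\eta(i)=n+1-i$. For every $\pi\in\mathfrak{S}_n$, as polynomials in $x$, \[\Omega'^{(\ell)}(\pi;x)=\Omega'^{(r)}(\pi\eta;x)\qquad\text{and}\qquad \Omega'(\pi;x)=\overline{\Omega}'(\eta\pi;x).\]
   Context: $\mathfrak{S}_n$ is the symmetric group on $[n]$; products are composition, $(\sigma\tau)(i)=\sigma(\tau(i))$. $\mathrm{Des}(\pi)=\{i\in[n-1]:\pi(i)>\pi(i+1)\}$. For $k\ge0$ let $[k]^{(\ell)}=\{0,-1,1,-2,2,\dots,-k,k\}$ with total order $0<-1<1<-2<2<\cdots<-k<k$, and $[k]'=[k]^{(\ell)}\setminus\{0\}$. Integers $\ge0$ are nonnegative, the others negative. In a totally ordered set $Y$ of integers, $a\le^+b$ means $a<b$ in $Y$ or $a=b\ge0$; $a\le^-b$ means $a<b$ in $Y$ or $a=b<0$. $N(\pi;Y)$ is the number of $(a_1,\dots,a_n)\in Y^n$ with $a_s\le^+a_{s+1}$ for $s\in[n-1]\setminus\mathrm{Des}(\pi)$ and $a_s\le^-a_{s+1}$ for $s\in\mathrm{Des}(\pi)$. $\Omega'(\pi;k)=N(\pi;[k]')$; $\Omega'^{(\ell)}(\pi;k)=N(\pi;[k]^{(\ell)})$; $\Omega'^{(r)}(\pi;k)=N(\pi;[k]'\cup\{ -(k+1)\})$ with $-(k+1)$ adjoined as the largest element; $\overline{\Omega}'(\pi;k)=N(\pi;[k-1]^{(\ell)}\cup\{ -k\})$ ($k\ge1$)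 with $-k$ adjoined as the largest element. Each is a polynomial function of $k$; the same symbols with argument $x$ denote these polynomials. -}

module Defs where

open import Data.Nat using (ℕ; zero; suc; _<ᵇ_; _≡ᵇ_)
open import Data.Bool using (Bool; true; false; _∧_; _∨_; if_then_else_)
open import Data.Integer using (ℤ; +_; -[1+_])
open import Data.Fin using (Fin; toℕ)
open import Data.List using (List; []; _∷_; _++_; [_]; map; concatMap; length; filterᵇ; allFin; upTo; lookup)
open import Data.Fin.Permutation using (Permutation′; _⟨$⟩ʳ_; _∘ₚ_; reverse)

-- Composition in the paper's convention: (σ · τ)(i) = σ (τ i).
-- (stdlib's  τ ∘ₚ σ  applies τ first, then σ.)
_·_ : ∀ {n} → Permutation′ n → Permutation′ n → Permutation′ n
σ · τ = τ ∘ₚ σ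

-- η(i) = n + 1 - i  (0-indexed: i ↦ n - 1 - i, i.e. Data.Fin.opposite)
η : ∀ {n} → Permutation′ n
η = reverse

oneLine : ∀ {n} → Permutation′ n → List ℕ
oneLine {n} π = map (λ i → toℕ (π ⟨$⟩ʳ i)) (allFin n)

-- A finite totally ordered set Y of integers is given as a list, listed in
-- increasing order (the order of Y is the position in the list).
-- An element of Y is represented by its position j : Fin (length Y).

nonneg : ℤ → Bool
nonneg (+ _)     = true
nonneg -[1+ _ ]  = false

le⁺ : (Y : List ℤ) → Fin (length Y) → Fin (length Y) → Bool
le⁺ Y a b = (toℕ a <ᵇ toℕ b) ∨ ((toℕ a ≡ᵇ toℕ b) ∧ nonneg (lookup Y a))

le⁻ : (Y : List ℤ) → Fin (length Y) → Fin (length Y) → Bool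
le⁻ Y a b = (toℕ a <ᵇ toℕ b) ∨ ((toℕ a ≡ᵇ toℕ b) ∧ (if nonneg (lookup Y a) then false else true))

compat : (Y : List ℤ) → List ℕ → List (Fin (length Y)) → Bool
compat Y (p ∷ q ∷ ps) (a ∷ b ∷ as) =
  (if q <ᵇ p then le⁻ Y a b else le⁺ Y a b) ∧ compat Y (q ∷ ps) (b ∷ as)
compat Y _ _ = true

words : {A : Set} → List A → ℕ → List (List A)
words xs zero    = [] ∷ []
words xs (suc n) = concatMap (λ x → map (x ∷_) (words xs n)) xs

N : ∀ {n} → Permutation′ n → List ℤ → ℕ
N {n} π Y = length (filterᵇ (compat Y (oneLine π)) (words (allFin (length Y)) n))

pm : ℕ → List ℤ
pm k = concatMap (λ i → -[1+ i ] ∷ + suc i ∷ []) (upTo k)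

-- [k]^(ℓ) = 0 < -1 < 1 < ... < -k < k
ordL : ℕ → List ℤ
ordL k = + 0 ∷ pm k

-- [k]' = -1 < 1 < ... < -k < k
ordP : ℕ → List ℤ
ordP k = pm k

Ω′ : ∀ {n} → Permutation′ n → ℕ → ℕ
Ω′ π k = N π (ordP k)

Ω′ˡ : ∀ {n} → Permutation′ n → ℕ → ℕ
Ω′ˡ π k = N π (ordL k)

-- [k]' ∪ {-(k+1)}, with -(k+1) largest
Ω′ʳ : ∀ {n} → Permutation′ n → ℕ → ℕ
Ω′ʳ π k = N π (ordP k ++ [ -[1+ k ] ])

-- \overline{Ω}'(π; k) for k ≥ 1: [k-1]^(ℓ) ∪ {-k}, with -k largest.
-- Given as a function of k ≥ 1 via its argument  suc k  (k+1 ↦ [k]^(ℓ) ∪ {-(k+1)}).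
Ω′bar : ∀ {n} → Permutation′ n → ℕ → ℕ
Ω′bar π zero    = 0   -- not used (undefined for k = 0 in the paper)
Ω′bar π (suc k) = N π (ordL k ++ [ -[1+ k ] ])

-- N(π; Y) counts the words a₁ ⋯ aₙ over Y with aₛ ≤⁻ aₛ₊₁ at the descents s of π and
-- aₛ ≤⁺ aₛ₊₁ elsewhere: the total weight of walks through a product of 0/1 transfer
-- matrices, one per position. Transposing that product counts the same words read
-- backwards, and relabelling Y by a bijection does not change the count. Both ≤⁺ and ≤⁻
-- are the order of positions in Y and differ only at ties, which ≤⁺ allows exactly at
-- nonnegative elements. For the first identity, j ↦ 2k − j maps the positions of [k]^(ℓ)
-- onto those of [k]' ∪ {−(k+1)}, reversing the order and flipping every sign, while the
-- descents of πη are the non-descents of π read backwards. For the second, [k+1]' and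
-- [k]^(ℓ) ∪ {−(k+1)} have the same length and opposite signs at every position, while the
-- descents of ηπ are the non-descents of π.

module Submission where

open import Defs
open import Data.Bool using (Bool; true; false; not; _∧_; _∨_; _xor_; T; T?; if_then_else_)
open import Data.Bool.Properties using (not-involutive; xor-identityʳ)
open import Data.Fin using (Fin; zero; suc; toℕ; inject₁; fromℕ; opposite)
open import Data.Fin.Permutation
  using (Permutation; Permutation′; _⟨$⟩ʳ_; _⟨$⟩ˡ_; inverseˡ; reverse; cast-id; _∘ₚ_)
open import Data.Fin.Properties
  using (toℕ<n; toℕ-injective; toℕ-inject₁; toℕ-cast; toℕ≤pred[n]; opposite-prop; opposite-involutive)
open import Data.Integer using (ℤ; -[1+_])
import Data.Integer as ℤ
open import Data.List
  using (List; []; _∷_; _++_; [_]; map; concatMap; length; filterᵇ; allFin; tabulate; lookup; upTo)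
open import Data.List.Properties using (filter-++; length-++; map-tabulate; length-upTo)
open import Data.Nat using (ℕ; zero; suc; _+_; _*_; _∸_; _≤_; z≤n; s≤s; _<ᵇ_; _≡ᵇ_)
open import Data.Nat.Properties
  using (+-*-semiring; *-assoc; *-comm; *-identityˡ; *-identityʳ; +-identityʳ; +-comm; +-suc; 1+n≢n;
         <ᵇ-reflects-<; ≡ᵇ⇒≡; ≡⇒≡ᵇ; ∸-monoʳ-<; ∸-monoʳ-≤; ∸-cancelˡ-≡; <⇒≱; <⇒≯; ≰⇒>; ≮⇒≥; ≤∧≢⇒<)
open import Algebra.Properties.Semiring.Sum +-*-semiring
  using (sum-syntax; sum-cong-≗; ∑-comm; ∑-permute; *-distribˡ-sum; *-distribʳ-sum)
open import Data.Product using (_×_; _,_)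
open import Function using (_∘_; flip; id; const)
open import Relation.Binary.PropositionalEquality
  using (_≡_; _≢_; _≗_; refl; sym; trans; cong; cong₂; subst; module ≡-Reasoning)
open import Relation.Nullary.Reflects using (Reflects; ofʸ; ofⁿ; fromEquivalence; det; ¬-reflects)

open ≡-Reasoning

-- Walks through 0/1 transfer matrices

iverson : Bool → ℕ
iverson true  = 1
iverson false = 0

BoolRel : ℕ → Set
BoolRel M = Fin M → Fin M → Bool

step : ∀ {M} → BoolRel M → (Fin M → ℕ) → Fin M → ℕ
step {M} R w y = ∑[ z < M ] (iverson (R y z) * w z)

step-cong : ∀ {M} (R : BoolRel M) {u v : Fin M → ℕ} → u ≗ v → step R u ≗ step R v
step-cong R u≗v y = sum-cong-≗ (λ z → cong (iverson (R y z) *_) (u≗v z))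

step-adjoint : ∀ {M} (R : BoolRel M) (u w : Fin M → ℕ) →
  ∑[ y < M ] (u y * step R w y) ≡ ∑[ z < M ] (step (flip R) u z * w z)
step-adjoint {M} R u w = begin
  ∑[ y < M ] (u y * step R w y)
    ≡⟨ sum-cong-≗ (λ y → *-distribˡ-sum (u y) (λ z → χ y z * w z)) ⟩
  ∑[ y < M ] ∑[ z < M ] (u y * (χ y z * w z))
    ≡⟨ ∑-comm (λ y z → u y * (χ y z * w z)) ⟩
  ∑[ z < M ] ∑[ y < M ] (u y * (χ y z * w z))
    ≡⟨ sum-cong-≗ (λ z → sum-cong-≗ (λ y → swap-assoc (u y) (χ y z) (w z))) ⟩
  ∑[ z < M ] ∑[ y < M ] (χ y z * u y * w z)
    ≡⟨ sum-cong-≗ (λ z → sym (*-distribʳ-sum (w z) (λ y → χ y z * u y))) ⟩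
  ∑[ z < M ] (step (flip R) u z * w z) ∎
  where
  χ : Fin M → Fin M → ℕ
  χ y z = iverson (R y z)
  swap-assoc : ∀ a b c → a * (b * c) ≡ b * a * c
  swap-assoc a b c = trans (sym (*-assoc a b c)) (cong (_* c) (*-comm a b))

-- walks Rs w y sums w aₘ over all a₀ = y, a₁, …, aₘ with Rs i aᵢ aᵢ₊₁ for every i.
walks : ∀ {m M} → (Fin m → BoolRel M) → (Fin M → ℕ) → Fin M → ℕ
walks {zero}  Rs w = w
walks {suc m} Rs w = step (Rs zero) (walks (Rs ∘ suc) w)

walks-cong : ∀ {m M} {Rs Ss : Fin m → BoolRel M} → (∀ i → Rs i ≡ Ss i) →
  ∀ w → walks Rs w ≗ walks Ss w
walks-cong {zero}  Rs≡Ss w y = refl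
walks-cong {suc m} {Rs = Rs} {Ss} Rs≡Ss w y =
  trans (cong (λ R → step R (walks (Rs ∘ suc) w) y) (Rs≡Ss zero))
        (step-cong (Ss zero) (walks-cong (Rs≡Ss ∘ suc) w) y)

walks-snoc : ∀ {m M} (Rs : Fin (suc m) → BoolRel M) w →
  walks Rs w ≗ walks (Rs ∘ inject₁) (step (Rs (fromℕ m)) w)
walks-snoc {zero}  Rs w y = refl
walks-snoc {suc m} Rs w   = step-cong (Rs zero) (walks-snoc (Rs ∘ suc) w)

converse : ∀ {m M} → (Fin m → BoolRel M) → Fin m → BoolRel M
converse Rs i = flip (Rs (opposite i))

opposite-inject₁ : ∀ {n} (i : Fin n) → opposite (inject₁ i) ≡ suc (opposite i)
opposite-inject₁ {suc n} zero    = refl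
opposite-inject₁ {suc n} (suc i) = cong inject₁ (opposite-inject₁ i)

walks-converse-suc : ∀ {m M} (Rs : Fin (suc m) → BoolRel M) u →
  walks (converse Rs) u ≗ walks (converse (Rs ∘ suc)) (step (flip (Rs zero)) u)
walks-converse-suc {m} Rs u y = begin
  walks (converse Rs) u y
    ≡⟨ walks-snoc (converse Rs) u y ⟩
  walks (converse Rs ∘ inject₁) (step (converse Rs (fromℕ m)) u) y
    ≡⟨ walks-cong (λ i → cong (flip ∘ Rs) (opposite-inject₁ i)) _ y ⟩
  walks (converse (Rs ∘ suc)) (step (converse Rs (fromℕ m)) u) y
    ≡⟨ cong (λ i → walks (converse (Rs ∘ suc)) (step (flip (Rs i)) u) y)
            (opposite-involutive zero) ⟩
  walks (converse (Rs ∘ suc)) (step (flip (Rs zero)) u) y ∎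

walks-adjoint : ∀ {m M} (Rs : Fin m → BoolRel M) (u w : Fin M → ℕ) →
  ∑[ y < M ] (u y * walks Rs w y) ≡ ∑[ y < M ] (walks (converse Rs) u y * w y)
walks-adjoint {zero}      Rs u w = refl
walks-adjoint {suc m} {M} Rs u w = begin
  ∑[ y < M ] (u y * step (Rs zero) (walks (Rs ∘ suc) w) y)
    ≡⟨ step-adjoint (Rs zero) u (walks (Rs ∘ suc) w) ⟩
  ∑[ y < M ] (step (flip (Rs zero)) u y * walks (Rs ∘ suc) w y)
    ≡⟨ walks-adjoint (Rs ∘ suc) (step (flip (Rs zero)) u) w ⟩
  ∑[ y < M ] (walks (converse (Rs ∘ suc)) (step (flip (Rs zero)) u) y * w y)
    ≡⟨ sum-cong-≗ (λ y → cong (_* w y) (sym (walks-converse-suc Rs u y))) ⟩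
  ∑[ y < M ] (walks (converse Rs) u y * w y) ∎

∑-walks-converse : ∀ {m M} (Rs : Fin m → BoolRel M) →
  ∑[ y < M ] walks Rs (const 1) y ≡ ∑[ y < M ] walks (converse Rs) (const 1) y
∑-walks-converse {M = M} Rs = begin
  ∑[ y < M ] walks Rs (const 1) y
    ≡⟨ sum-cong-≗ (λ y → sym (*-identityˡ (walks Rs (const 1) y))) ⟩
  ∑[ y < M ] (1 * walks Rs (const 1) y)
    ≡⟨ walks-adjoint Rs (const 1) (const 1) ⟩
  ∑[ y < M ] (walks (converse Rs) (const 1) y * 1)
    ≡⟨ sum-cong-≗ (λ y → *-identityʳ (walks (converse Rs) (const 1) y)) ⟩
  ∑[ y < M ] walks (converse Rs) (const 1) y ∎

module _ {M M′} (σ : Permutation M M′) where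

  step-relabel : ∀ {R : BoolRel M} {S : BoolRel M′} →
    (∀ a b → S (σ ⟨$⟩ʳ a) (σ ⟨$⟩ʳ b) ≡ R a b) →
    ∀ w a → step S w (σ ⟨$⟩ʳ a) ≡ step R (w ∘ (σ ⟨$⟩ʳ_)) a
  step-relabel S∼R w a =
    trans (∑-permute _ σ) (sum-cong-≗ (λ z → cong (λ b → iverson b * w (σ ⟨$⟩ʳ z)) (S∼R a z)))

  walks-relabel : ∀ {m} {Rs : Fin m → BoolRel M} {Ss : Fin m → BoolRel M′} →
    (∀ i a b → Ss i (σ ⟨$⟩ʳ a) (σ ⟨$⟩ʳ b) ≡ Rs i a b) →
    ∀ w a → walks Ss w (σ ⟨$⟩ʳ a) ≡ walks Rs (w ∘ (σ ⟨$⟩ʳ_)) a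
  walks-relabel {zero}                Ss∼Rs w a = refl
  walks-relabel {suc m} {Rs} {Ss} Ss∼Rs w a =
    trans (step-relabel {S = Ss zero} (Ss∼Rs zero) (walks (Ss ∘ suc) w) a)
          (step-cong (Rs zero) (walks-relabel (Ss∼Rs ∘ suc) w) a)

  ∑-walks-relabel : ∀ {m} {Rs : Fin m → BoolRel M} {Ss : Fin m → BoolRel M′} →
    (∀ i a b → Ss i (σ ⟨$⟩ʳ a) (σ ⟨$⟩ʳ b) ≡ Rs i a b) →
    ∑[ y < M′ ] walks Ss (const 1) y ≡ ∑[ y < M ] walks Rs (const 1) y
  ∑-walks-relabel Ss∼Rs = trans (∑-permute _ σ) (sum-cong-≗ (walks-relabel Ss∼Rs (const 1)))

-- Counting words

count : {A : Set} → (A → Bool) → List A → ℕ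
count p xs = length (filterᵇ p xs)

count-++ : {A : Set} (p : A → Bool) (xs ys : List A) →
  count p (xs ++ ys) ≡ count p xs + count p ys
count-++ p xs ys = trans (cong length (filter-++ (T? ∘ p) xs ys)) (length-++ (filterᵇ p xs))

count-map : {A B : Set} (p : B → Bool) (f : A → B) (xs : List A) →
  count p (map f xs) ≡ count (p ∘ f) xs
count-map p f []       = refl
count-map p f (x ∷ xs) with p (f x)
... | true  = cong suc (count-map p f xs)
... | false = count-map p f xs

count-cong : {A : Set} {p q : A → Bool} → p ≗ q → count p ≗ count q
count-cong p≗q []       = refl
count-cong {q = q} p≗q (x ∷ xs) rewrite p≗q x with q x
... | true  = cong suc (count-cong p≗q xs)
... | false = count-cong p≗q xs

count-false : {A : Set} (xs : List A) → count (const false) xs ≡ 0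
count-false []       = refl
count-false (x ∷ xs) = count-false xs

count-∧ : {A : Set} (b : Bool) (p : A → Bool) (xs : List A) →
  count (λ x → b ∧ p x) xs ≡ iverson b * count p xs
count-∧ true  p xs = sym (+-identityʳ _)
count-∧ false p xs = count-false xs

count-concatMap : {A B : Set} {M : ℕ} (p : B → Bool) (h : A → List B) (f : Fin M → A) →
  count p (concatMap h (tabulate f)) ≡ ∑[ i < M ] count p (h (f i))
count-concatMap {M = zero}  p h f = refl
count-concatMap {M = suc M} p h f =
  trans (count-++ p (h (f zero)) _) (cong (count p (h (f zero)) +_) (count-concatMap p h (f ∘ suc)))

count-words-suc : ∀ {M m} (p : List (Fin M) → Bool) →
  count p (words (allFin M) (suc m)) ≡ ∑[ y < M ] count (p ∘ (y ∷_)) (words (allFin M) m)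
count-words-suc {M} {m} p =
  trans (count-concatMap p (λ x → map (x ∷_) (words (allFin M) m)) id)
        (sum-cong-≗ (λ y → count-map p (y ∷_) (words (allFin M) m)))

holds : ∀ {m M} → (Fin m → BoolRel M) → List (Fin M) → Bool
holds {suc m} Rs (a ∷ b ∷ as) = Rs zero a b ∧ holds (Rs ∘ suc) (b ∷ as)
holds         Rs _            = true

count-holds≡walks : ∀ {M} m (Rs : Fin m → BoolRel M) y →
  count (holds Rs ∘ (y ∷_)) (words (allFin M) m) ≡ walks Rs (const 1) y
count-holds≡walks         zero    Rs y = refl
count-holds≡walks {M = M} (suc m) Rs y = begin
  count (holds Rs ∘ (y ∷_)) (words (allFin M) (suc m))
    ≡⟨ count-words-suc {m = m} (holds Rs ∘ (y ∷_)) ⟩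
  ∑[ z < M ] count (λ as → Rs zero y z ∧ holds (Rs ∘ suc) (z ∷ as)) W
    ≡⟨ sum-cong-≗ (λ z → count-∧ (Rs zero y z) _ W) ⟩
  ∑[ z < M ] (iverson (Rs zero y z) * count (holds (Rs ∘ suc) ∘ (z ∷_)) W)
    ≡⟨ step-cong (Rs zero) (count-holds≡walks m (Rs ∘ suc)) y ⟩
  walks Rs (const 1) y ∎
  where
  W = words (allFin M) m

stepRel : (Y : List ℤ) → Bool → BoolRel (length Y)
stepRel Y d a b = if d then le⁻ Y a b else le⁺ Y a b

descents : ∀ {m} → (Fin (suc m) → ℕ) → Fin m → Bool
descents g s = g (suc s) <ᵇ g (inject₁ s)

compat-holds : ∀ Y {m} (g : Fin (suc m) → ℕ) →
  compat Y (tabulate g) ≗ holds (stepRel Y ∘ descents g)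
compat-holds Y {zero}  g as                = refl
compat-holds Y {suc m} g []                = refl
compat-holds Y {suc m} g (a ∷ [])          = refl
compat-holds Y {suc m} g (a ∷ b ∷ as) =
  cong (stepRel Y (g (suc zero) <ᵇ g zero) a b ∧_) (compat-holds Y (g ∘ suc) (b ∷ as))

oneLineFn : ∀ {n} → Permutation′ n → Fin n → ℕ
oneLineFn π i = toℕ (π ⟨$⟩ʳ i)

N≡∑walks : ∀ {m} (π : Permutation′ (suc m)) Y →
  N π Y ≡ ∑[ y < length Y ] walks (stepRel Y ∘ descents (oneLineFn π)) (const 1) y
N≡∑walks {m} π Y = begin
  count (compat Y (oneLine π)) (words (allFin M) (suc m))
    ≡⟨ cong (λ w → count (compat Y w) (words (allFin M) (suc m)))
            (map-tabulate id (oneLineFn π)) ⟩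
  count (compat Y (tabulate (oneLineFn π))) (words (allFin M) (suc m))
    ≡⟨ count-cong (compat-holds Y (oneLineFn π)) (words (allFin M) (suc m)) ⟩
  count (holds Rs) (words (allFin M) (suc m))
    ≡⟨ count-words-suc {m = m} (holds Rs) ⟩
  ∑[ y < M ] count (holds Rs ∘ (y ∷_)) (words (allFin M) m)
    ≡⟨ sum-cong-≗ (count-holds≡walks m Rs) ⟩
  ∑[ y < M ] walks Rs (const 1) y ∎
  where
  M = length Y
  Rs = stepRel Y ∘ descents (oneLineFn π)

reflects-⇔ : ∀ {A B : Set} {b} → Reflects A b → (A → B) → (B → A) → Reflects B b
reflects-⇔ (ofʸ a)  f g = ofʸ (f a)
reflects-⇔ (ofⁿ ¬a) f g = ofⁿ (¬a ∘ g)

≡ᵇ-reflects-≡ : ∀ m n → Reflects (m ≡ n) (m ≡ᵇ n)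
≡ᵇ-reflects-≡ m n = fromEquivalence (≡ᵇ⇒≡ m n) (≡⇒≡ᵇ m n)

<ᵇ-flip : ∀ {x y} → x ≢ y → (x <ᵇ y) ≡ not (y <ᵇ x)
<ᵇ-flip {x} {y} x≢y = det (<ᵇ-reflects-< x y)
  (reflects-⇔ (¬-reflects (<ᵇ-reflects-< y x)) (λ y≮x → ≤∧≢⇒< (≮⇒≥ y≮x) x≢y) <⇒≯)

<ᵇ-∸-reverse : ∀ {L x y} → x ≤ L → y ≤ L → (L ∸ x <ᵇ L ∸ y) ≡ (y <ᵇ x)
<ᵇ-∸-reverse {L} {x} {y} x≤L y≤L = det (<ᵇ-reflects-< (L ∸ x) (L ∸ y))
  (reflects-⇔ (<ᵇ-reflects-< y x) (λ y<x → ∸-monoʳ-< y<x x≤L)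
              (λ lt → ≰⇒> (λ x≤y → <⇒≱ lt (∸-monoʳ-≤ L x≤y))))

≡ᵇ-∸-reverse : ∀ {L x y} → x ≤ L → y ≤ L → (L ∸ x ≡ᵇ L ∸ y) ≡ (y ≡ᵇ x)
≡ᵇ-∸-reverse {L} {x} {y} x≤L y≤L = det (≡ᵇ-reflects-≡ (L ∸ x) (L ∸ y))
  (reflects-⇔ (≡ᵇ-reflects-≡ y x) (λ y≡x → cong (L ∸_) (sym y≡x))
              (λ eq → sym (∸-cancelˡ-≡ x≤L y≤L eq)))

-- le⁺ and le⁻ compare positions in this way, with the tie bit t saying whether the
-- element at the first position is nonnegative, resp. negative.
infix 5 _≤[_]_
_≤[_]_ : ℕ → Bool → ℕ → Bool
x ≤[ t ] y = (x <ᵇ y) ∨ ((x ≡ᵇ y) ∧ t)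

≤[]-reflect : ∀ {L x y} t → x ≤ L → y ≤ L → (L ∸ x) ≤[ t ] (L ∸ y) ≡ y ≤[ t ] x
≤[]-reflect t x≤L y≤L =
  cong₂ (λ lt eq → lt ∨ (eq ∧ t)) (<ᵇ-∸-reverse x≤L y≤L) (≡ᵇ-∸-reverse x≤L y≤L)

≤[]-tie-cong : ∀ {x y t t′} → (x ≡ y → t ≡ t′) → x ≤[ t ] y ≡ x ≤[ t′ ] y
≤[]-tie-cong {x} {y} t≡t′ with x ≡ᵇ y in x≡ᵇy
... | false = refl
... | true  = cong ((x <ᵇ y) ∨_) (t≡t′ (≡ᵇ⇒≡ x y (subst T (sym x≡ᵇy) _)))

HasSigns : List ℤ → (ℕ → Bool) → Set
HasSigns Y s = ∀ a → nonneg (lookup Y a) ≡ s (toℕ a)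

stepRel-≤[] : ∀ Y s → HasSigns Y s →
  ∀ d a b → stepRel Y d a b ≡ toℕ a ≤[ d xor s (toℕ a) ] toℕ b
stepRel-≤[] Y s signs false a b = cong (λ t → toℕ a ≤[ t ] toℕ b) (signs a)
stepRel-≤[] Y s signs true  a b =
  cong (λ t → toℕ a ≤[ t ] toℕ b) (trans (if-not (nonneg (lookup Y a))) (cong not (signs a)))
  where
  if-not : ∀ b → (if b then false else true) ≡ not b
  if-not true  = refl
  if-not false = refl

not-xor-not : ∀ x y → not x xor not y ≡ x xor y
not-xor-not true  y = refl
not-xor-not false y = not-involutive y

stepRel-reverse : ∀ {L} Y s Y′ s′ → HasSigns Y s → HasSigns Y′ s′ →
  (∀ x → x ≤ L → s′ (L ∸ x) ≡ not (s x)) →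
  (c : Fin (length Y) → Fin (length Y′)) →
  (∀ a → toℕ a ≤ L) → (∀ a → toℕ (c a) ≡ L ∸ toℕ a) →
  ∀ d a b → stepRel Y′ (not d) (c a) (c b) ≡ stepRel Y d b a
stepRel-reverse {L} Y s Y′ s′ signs signs′ s′∘reflect c bound toℕ-c d a b = begin
  stepRel Y′ (not d) (c a) (c b)
    ≡⟨ stepRel-≤[] Y′ s′ signs′ (not d) (c a) (c b) ⟩
  toℕ (c a) ≤[ not d xor s′ (toℕ (c a)) ] toℕ (c b)
    ≡⟨ cong₂ (λ x y → x ≤[ not d xor s′ x ] y) (toℕ-c a) (toℕ-c b) ⟩
  (L ∸ A) ≤[ not d xor s′ (L ∸ A) ] (L ∸ B)
    ≡⟨ ≤[]-reflect _ (bound a) (bound b) ⟩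
  B ≤[ not d xor s′ (L ∸ A) ] A
    ≡⟨ ≤[]-tie-cong tie ⟩
  B ≤[ d xor s B ] A
    ≡⟨ sym (stepRel-≤[] Y s signs d b a) ⟩
  stepRel Y d b a ∎
  where
  A = toℕ a
  B = toℕ b
  tie : B ≡ A → not d xor s′ (L ∸ A) ≡ d xor s B
  tie B≡A = begin
    not d xor s′ (L ∸ A) ≡⟨ cong (not d xor_) (s′∘reflect A (bound a)) ⟩
    not d xor not (s A)  ≡⟨ not-xor-not d (s A) ⟩
    d xor s A            ≡⟨ cong (λ x → d xor s x) (sym B≡A) ⟩
    d xor s B            ∎

stepRel-complement : ∀ Y s Y′ s′ → HasSigns Y s → HasSigns Y′ s′ →
  (∀ x → s′ x ≡ not (s x)) →
  (c : Fin (length Y) → Fin (length Y′)) → (∀ a → toℕ (c a) ≡ toℕ a) →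
  ∀ d a b → stepRel Y′ (not d) (c a) (c b) ≡ stepRel Y d a b
stepRel-complement Y s Y′ s′ signs signs′ s′≡not-s c toℕ-c d a b = begin
  stepRel Y′ (not d) (c a) (c b)
    ≡⟨ stepRel-≤[] Y′ s′ signs′ (not d) (c a) (c b) ⟩
  toℕ (c a) ≤[ not d xor s′ (toℕ (c a)) ] toℕ (c b)
    ≡⟨ cong₂ (λ x y → x ≤[ not d xor s′ x ] y) (toℕ-c a) (toℕ-c b) ⟩
  A ≤[ not d xor s′ A ] B
    ≡⟨ cong (λ t → A ≤[ t ] B) tie ⟩
  A ≤[ d xor s A ] B
    ≡⟨ sym (stepRel-≤[] Y s signs d a b) ⟩
  stepRel Y d a b ∎
  where
  A = toℕ a
  B = toℕ b
  tie : not d xor s′ A ≡ d xor s A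
  tie = trans (cong (not d xor_) (s′≡not-s A)) (not-xor-not d (s A))

-- Sign patterns of the alphabets

odd : ℕ → Bool
odd zero          = false
odd (suc zero)    = true
odd (suc (suc n)) = odd n

odd-suc : ∀ n → odd (suc n) ≡ not (odd n)
odd-suc zero          = refl
odd-suc (suc zero)    = refl
odd-suc (suc (suc n)) = odd-suc n

odd-∸ : ∀ {m n} → n ≤ m → odd (m ∸ n) ≡ odd m xor odd n
odd-∸ {m} z≤n = sym (xor-identityʳ (odd m))
odd-∸ (s≤s {n} {m} n≤m) =
  trans (odd-∸ n≤m) (sym (trans (cong₂ _xor_ (odd-suc m) (odd-suc n)) (not-xor-not (odd m) (odd n))))

pairs : List ℕ → List ℤ
pairs = concatMap (λ i → -[1+ i ] ∷ ℤ.+ suc i ∷ [])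

signs-pairs : ∀ zs → HasSigns (pairs zs) odd
signs-pairs (z ∷ zs) zero          = refl
signs-pairs (z ∷ zs) (suc zero)    = refl
signs-pairs (z ∷ zs) (suc (suc a)) = signs-pairs zs a

signs-pairs-∷ʳ : ∀ zs j → HasSigns (pairs zs ++ [ -[1+ j ] ]) odd
signs-pairs-∷ʳ []       j zero          = refl
signs-pairs-∷ʳ (z ∷ zs) j zero          = refl
signs-pairs-∷ʳ (z ∷ zs) j (suc zero)    = refl
signs-pairs-∷ʳ (z ∷ zs) j (suc (suc a)) = signs-pairs-∷ʳ zs j a

signs-∷-nonneg : ∀ {Y} n → HasSigns Y odd → HasSigns (ℤ.+ n ∷ Y) (not ∘ odd)
signs-∷-nonneg n signs zero    = refl
signs-∷-nonneg n signs (suc a) =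
  trans (signs a) (sym (trans (cong not (odd-suc (toℕ a))) (not-involutive (odd (toℕ a)))))

odd-length-pairs : ∀ zs → odd (length (pairs zs)) ≡ false
odd-length-pairs []       = refl
odd-length-pairs (z ∷ zs) = odd-length-pairs zs

length-pairs : ∀ zs → length (pairs zs) ≡ length zs + length zs
length-pairs []       = refl
length-pairs (z ∷ zs) =
  cong suc (trans (cong suc (length-pairs zs)) (sym (+-suc (length zs) (length zs))))

length-∷ʳ : {A : Set} (xs : List A) (x : A) → length (xs ++ [ x ]) ≡ suc (length xs)
length-∷ʳ xs x = trans (length-++ xs) (+-comm (length xs) 1)

length-pm : ∀ k → length (pm k) ≡ k + k
length-pm k = trans (length-pairs (upTo k)) (cong₂ _+_ (length-upTo k) (length-upTo k))

-- Descents of πη and ηπ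

adjacent-≢ : ∀ {m n} (π : Permutation (suc m) n) (s : Fin m) → π ⟨$⟩ʳ inject₁ s ≢ π ⟨$⟩ʳ suc s
adjacent-≢ π s eq = 1+n≢n (sym (trans (sym (toℕ-inject₁ s)) (cong toℕ inject₁≡suc)))
  where
  inject₁≡suc : inject₁ s ≡ suc s
  inject₁≡suc = trans (sym (inverseˡ π)) (trans (cong (π ⟨$⟩ˡ_) eq) (inverseˡ π))

descents-reverse : ∀ {m} (g : Fin (suc m) → ℕ) → (∀ s → g (inject₁ s) ≢ g (suc s)) →
  ∀ s → descents (g ∘ opposite) s ≡ not (descents g (opposite s))
descents-reverse g distinct s = begin
  g (inject₁ t) <ᵇ g (opposite (inject₁ s)) ≡⟨ cong (λ i → g (inject₁ t) <ᵇ g i) (opposite-inject₁ s) ⟩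
  g (inject₁ t) <ᵇ g (suc t)                ≡⟨ <ᵇ-flip (distinct t) ⟩
  not (g (suc t) <ᵇ g (inject₁ t))          ∎
  where
  t = opposite s

descents-complement : ∀ {m n} (f : Fin (suc m) → Fin n) → (∀ s → f (inject₁ s) ≢ f (suc s)) →
  ∀ s → descents (toℕ ∘ opposite ∘ f) s ≡ not (descents (toℕ ∘ f) s)
descents-complement {n = n} f distinct s = begin
  toℕ (opposite (f (suc s))) <ᵇ toℕ (opposite (f (inject₁ s)))
    ≡⟨ cong₂ _<ᵇ_ (opposite-prop (f (suc s))) (opposite-prop (f (inject₁ s))) ⟩
  n ∸ suc q <ᵇ n ∸ suc p
    ≡⟨ <ᵇ-∸-reverse (toℕ<n (f (suc s))) (toℕ<n (f (inject₁ s))) ⟩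
  p <ᵇ q
    ≡⟨ <ᵇ-flip (distinct s ∘ toℕ-injective) ⟩
  not (q <ᵇ p) ∎
  where
  p = toℕ (f (inject₁ s))
  q = toℕ (f (suc s))

Ω′ˡ-reverse : ∀ {m} (π : Permutation′ (suc m)) k → Ω′ˡ π k ≡ Ω′ʳ (π · η) k
Ω′ˡ-reverse π k = begin
  Ω′ˡ π k                                                ≡⟨ N≡∑walks π (ordL k) ⟩
  ∑[ y < suc L ] walks Rs (const 1) y                    ≡⟨ ∑-walks-converse Rs ⟩
  ∑[ y < suc L ] walks (converse Rs) (const 1) y         ≡⟨ sym (∑-walks-relabel σ related) ⟩
  ∑[ y < length Yʳ ] walks Ss (const 1) y                ≡⟨ sym (N≡∑walks (π · η) Yʳ) ⟩
  Ω′ʳ (π · η) k                                          ∎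
  where
  g = oneLineFn π
  L = length (pm k)
  Yʳ = pm k ++ [ -[1+ k ] ]
  Rs = stepRel (ordL k) ∘ descents g
  Ss = stepRel Yʳ ∘ descents (g ∘ opposite)
  σ : Permutation (suc L) (length Yʳ)
  σ = reverse ∘ₚ cast-id (sym (length-∷ʳ (pm k) -[1+ k ]))
  toℕ-σ : ∀ a → toℕ (σ ⟨$⟩ʳ a) ≡ L ∸ toℕ a
  toℕ-σ a = trans (toℕ-cast _ (opposite a)) (opposite-prop a)
  parity : ∀ x → x ≤ L → odd (L ∸ x) ≡ not (not (odd x))
  parity x x≤L = begin
    odd (L ∸ x)       ≡⟨ odd-∸ x≤L ⟩
    odd L xor odd x   ≡⟨ cong (_xor odd x) (odd-length-pairs (upTo k)) ⟩
    odd x             ≡⟨ sym (not-involutive (odd x)) ⟩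
    not (not (odd x)) ∎
  related : ∀ s a b → Ss s (σ ⟨$⟩ʳ a) (σ ⟨$⟩ʳ b) ≡ converse Rs s a b
  related s a b = trans
    (cong (λ d → stepRel Yʳ d (σ ⟨$⟩ʳ a) (σ ⟨$⟩ʳ b))
          (descents-reverse g (λ t → adjacent-≢ π t ∘ toℕ-injective) s))
    (stepRel-reverse (ordL k) (not ∘ odd) Yʳ odd
       (signs-∷-nonneg 0 (signs-pairs (upTo k))) (signs-pairs-∷ʳ (upTo k) k) parity
       (σ ⟨$⟩ʳ_) toℕ≤pred[n] toℕ-σ (descents g (opposite s)) a b)

Ω′-complement : ∀ {m} (π : Permutation′ (suc m)) k → 1 ≤ k → Ω′ π k ≡ Ω′bar (η · π) k
Ω′-complement π (suc k) _ = begin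
  Ω′ π (suc k)                                     ≡⟨ N≡∑walks π (pm (suc k)) ⟩
  ∑[ y < length (pm (suc k)) ] walks Rs (const 1) y ≡⟨ sym (∑-walks-relabel σ related) ⟩
  ∑[ y < length Yᵇ ] walks Ss (const 1) y          ≡⟨ sym (N≡∑walks (η · π) Yᵇ) ⟩
  Ω′bar (η · π) (suc k)                            ∎
  where
  Yᵇ = ordL k ++ [ -[1+ k ] ]
  Rs = stepRel (pm (suc k)) ∘ descents (oneLineFn π)
  Ss = stepRel Yᵇ ∘ descents (oneLineFn (η · π))
  same-length : length (pm (suc k)) ≡ length Yᵇ
  same-length = begin
    length (pm (suc k))        ≡⟨ length-pm (suc k) ⟩
    suc k + suc k              ≡⟨ cong suc (+-suc k k) ⟩
    suc (suc (k + k))          ≡⟨ cong (λ x → suc (suc x)) (sym (length-pm k)) ⟩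
    suc (suc (length (pm k)))  ≡⟨ cong suc (sym (length-∷ʳ (pm k) -[1+ k ])) ⟩
    length Yᵇ                  ∎
  σ : Permutation (length (pm (suc k))) (length Yᵇ)
  σ = cast-id same-length
  related : ∀ s a b → Ss s (σ ⟨$⟩ʳ a) (σ ⟨$⟩ʳ b) ≡ Rs s a b
  related s a b = trans
    (cong (λ d → stepRel Yᵇ d (σ ⟨$⟩ʳ a) (σ ⟨$⟩ʳ b))
          (descents-complement (π ⟨$⟩ʳ_) (adjacent-≢ π) s))
    (stepRel-complement (pm (suc k)) odd Yᵇ (not ∘ odd)
       (signs-pairs (upTo (suc k))) (signs-∷-nonneg 0 (signs-pairs-∷ʳ (upTo k) k)) (λ _ → refl)
       (σ ⟨$⟩ʳ_) (toℕ-cast same-length) (descents (oneLineFn π) s) a b)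

proposition4p7 : (n : ℕ) → 1 ≤ n → (π : Permutation′ n) →
    ((k : ℕ) → Ω′ˡ π k ≡ Ω′ʳ (π · η) k)
    × ((k : ℕ) → 1 ≤ k → Ω′ π k ≡ Ω′bar (η · π) k)
proposition4p7 (suc m) _ π = Ω′ˡ-reverse π , Ω′-complement π
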